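{- Let $\Delta$ be a bounded, co-bounded $m$-invariant set with $m$-generators $a_0<a_1<\dots<a_{m-1}$, and define $\phi(\Delta)=(a_0,a_1,\dots,a_{m-1})-\frac{\sum_{j=0}^{m-1}a_j}{m}(1,1,\dots,1)\in V^m$. Then for every word $\mathbf{w}$ in the alphabet $[m]$ we have $\phi(\mathbf{w}\cdot\Delta)=\mathbf{w}\cdot\phi(\Delta)$, and $\phi(\Delta)$ is the centroid of an alcove.
   Context: $[m]=\{0,\dots,m-1\}$. A set $\Delta\subset\mathbb{Z}$ is $m$-invariant if $\Delta+m\subset\Delta$; bounded means it has a minimum, co-bounded means $\mathbb{Z}_{\ge K}\subset\Delta$ for some $K$. Its $m$-generators are the elements of $\Delta\setminus(\Delta+m)$. A letter $j\in[m]$ acts on $\Delta$ by removing its $j$-th smallest $m$-generator $a_j$ (indexing from $0$). On $V^m=\{\mathbf{x}\in\mathbb{R}^m:\sum x_i=0,\ x_0\le\dots\le x_{m-1}\}$, a letter $i$ acts by adding $m$ to $x_i$, subtracting $1$ from every coordinate, and sorting increasingly. Words $w_{k-1}\dots w_0$ act from right to left (first $w_0$) in both settings. Alcoves are closures of connected components of the complement of the arrangement $\{x_i-x_j=km:0\le i<j\le m-1,k\in\mathbb{Z}\}$ in $\{\sum x_i=0\}$; the centroid of an alcove $A$ is the unique point $\mathbf{x}$ in the interior of $A$ with $\frac{m+1}{2}-x_i\in\mathbb{Z}$ for all $i$. -}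

module Defs where

open import Level using (0ℓ; Lift)
import Level
open import Data.Nat as ℕ using (ℕ; zero; suc; NonZero)
open import Data.Integer as ℤ using (ℤ; +_)
open import Data.Rational as ℚ using (ℚ)
open import Data.Rational.Properties as ℚP using ()
open import Data.Fin as Fin using (Fin)
open import Data.Fin.Properties as FinP using ()
open import Data.Vec using (Vec; []; _∷_; lookup; tabulate; foldr)
open import Data.List using (List; []; _∷_)
open import Data.Product using (Σ; ∃; _×_; _,_)
open import Data.Bool using (if_then_else_)
open import Relation.Nullary using (¬_; does)
open import Relation.Binary.PropositionalEquality using (_≡_; _≢_)

ISet : Set₁
ISet = ℤ → Set

MInvariant : ℕ → ISet → Set
MInvariant m Δ = ∀ x → Δ x → Δ (x ℤ.+ + m)

Bounded : ISet → Set
Bounded Δ = Σ ℤ λ x₀ → Δ x₀ × (∀ x → Δ x → x₀ ℤ.≤ x)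

CoBounded : ISet → Set
CoBounded Δ = Σ ℤ λ K → ∀ x → K ℤ.≤ x → Δ x

IsGenerator : ℕ → ISet → ℤ → Set
IsGenerator m Δ x = Δ x × ¬ (Σ ℤ λ y → Δ y × x ≡ y ℤ.+ + m)

StrictlyIncreasing : ∀ {n} → Vec ℤ n → Set
StrictlyIncreasing {n} a = ∀ (i j : Fin n) → i Fin.< j → lookup a i ℤ.< lookup a j

Generators : (m : ℕ) → ISet → Vec ℤ m → Set
Generators m Δ a =
  StrictlyIncreasing a ×
  (∀ x → (IsGenerator m Δ x → Σ (Fin m) λ i → lookup a i ≡ x)
       × (Σ (Fin m) (λ i → lookup a i ≡ x) → IsGenerator m Δ x))

LetterAct : (m : ℕ) → Fin m → ISet → ISet → Set
LetterAct m j Δ Δ' =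
  Σ (Vec ℤ m) λ a → Generators m Δ a ×
    (∀ x → (Δ' x → Δ x × x ≢ lookup a j) × (Δ x × x ≢ lookup a j → Δ' x))

-- Words: the list  w_{k-1} ∷ … ∷ w₀ ∷ []  (w₀ acts first).
Word : ℕ → Set
Word m = List (Fin m)

WordAct : (m : ℕ) → Word m → ISet → ISet → Set₁
WordAct m [] Δ Δ' = Lift (Level.suc 0ℓ) (∀ x → (Δ x → Δ' x) × (Δ' x → Δ x))
WordAct m (j ∷ w) Δ Δ'' = Σ ISet λ Δ' → WordAct m w Δ Δ' × Lift (Level.suc 0ℓ) (LetterAct m j Δ' Δ'')

sumℤ : ∀ {n} → Vec ℤ n → ℤ
sumℤ = foldr _ ℤ._+_ (+ 0)

sumℚ : ∀ {n} → Vec ℚ n → ℚ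
sumℚ = foldr _ ℚ._+_ ℚ.0ℚ

φ : (m : ℕ) → .{{_ : NonZero m}} → Vec ℤ m → Vec ℚ m
φ m a = tabulate λ i → (lookup a i ℚ./ 1) ℚ.- (sumℤ a ℚ./ m)

InV : (m : ℕ) → Vec ℚ m → Set
InV m x = sumℚ x ≡ ℚ.0ℚ × (∀ (i j : Fin m) → i Fin.≤ j → lookup x i ℚ.≤ lookup x j)

insert : ∀ {n} → ℚ → Vec ℚ n → Vec ℚ (suc n)
insert x [] = x ∷ []
insert x (y ∷ ys) = if does (x ℚP.≤? y) then x ∷ y ∷ ys else y ∷ insert x ys

sortV : ∀ {n} → Vec ℚ n → Vec ℚ n
sortV [] = []
sortV (x ∷ xs) = insert x (sortV xs)

letterV : (m : ℕ) → Fin m → Vec ℚ m → Vec ℚ m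
letterV m i x = sortV (tabulate λ k →
  (if does (k Fin.≟ i) then lookup x k ℚ.+ (+ m ℚ./ 1) else lookup x k) ℚ.- ℚ.1ℚ)

wordV : (m : ℕ) → Word m → Vec ℚ m → Vec ℚ m
wordV m [] x = x
wordV m (j ∷ w) x = letterV m j (wordV m w x)

-- The open alcove indexed by k (k i j ∈ ℤ for i < j) is the set of x with
-- Σ x_i = 0 and k_{ij} m < x_i - x_j < (k_{ij}+1) m for all i < j; these are
-- exactly the connected components of the complement of the arrangement
-- {x_i - x_j = k m} in {Σ x_i = 0}, i.e. the interiors of the alcoves.
InAlcoveInterior : (m : ℕ) → (Fin m → Fin m → ℤ) → Vec ℚ m → Set
InAlcoveInterior m k x =
  sumℚ x ≡ ℚ.0ℚ ×
  (∀ (i j : Fin m) → i Fin.< j →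
     ((k i j ℤ.* + m) ℚ./ 1) ℚ.< (lookup x i ℚ.- lookup x j)
   × (lookup x i ℚ.- lookup x j) ℚ.< (((k i j ℤ.+ + 1) ℤ.* + m) ℚ./ 1))

IsCentroidOf : (m : ℕ) → (Fin m → Fin m → ℤ) → Vec ℚ m → Set
IsCentroidOf m k x =
  InAlcoveInterior m k x ×
  (∀ (i : Fin m) → Σ ℤ λ z → ((+ suc m) ℚ./ 2) ℚ.- lookup x i ≡ z ℚ./ 1)

IsAlcoveCentroid : (m : ℕ) → Vec ℚ m → Set
IsAlcoveCentroid m x = Σ (Fin m → Fin m → ℤ) λ k → IsCentroidOf m k x

{-# OPTIONS --safe #-}
module Submission where

-- Deleting the generator a_j from Δ leaves an m-invariant set whose generators are the
-- other a_i together with a_j + m, so on generator vectors a letter adds m to the j-th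
-- entry and re-sorts.  The generator sum grows by m, hence the mean grows by 1, and φ
-- turns this into the action on V^m.  The generators are pairwise incongruent mod m
-- (a_i + k m with k > 0 lies in Δ + m), so no difference φ_i - φ_j = a_i - a_j lies on
-- a wall x_i - x_j ∈ mℤ; and their residues are a permutation of 0, …, m - 1, so
-- 2 Σ a_j + m ≡ m² (mod 2m), which makes every (m + 1)/2 - φ_i an integer.

open import Defs
open import Data.Nat as ℕ using (ℕ; NonZero; zero; suc)
import Data.Nat.Properties as ℕP
open import Data.Integer as ℤ using (ℤ; +_; +[1+_]; -[1+_])
import Data.Integer.Properties as ℤP
open import Data.Integer.DivMod using (_%ℕ_; _/ℕ_; n%ℕd<d; a≡a%ℕn+[a/ℕn]*n; n<s[n/ℕd]*d)
open import Data.Integer.Tactic.RingSolver using (solve-∀)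
open import Data.Rational as ℚ using (ℚ)
import Data.Rational.Properties as ℚP
open import Data.Rational.Solver using (module +-*-Solver)
import Data.Rational.Unnormalised as ℚᵘ
import Data.Rational.Unnormalised.Properties as ℚᵘP
open import Data.Fin as Fin using (Fin)
open import Data.List using ([]; _∷_)
import Data.Fin.Properties as FinP
import Data.Fin.Permutation as Perm
open import Data.Vec using (Vec; []; _∷_; lookup; map; tabulate; updateAt)
open import Data.Vec.Properties
  using (lookup∘updateAt; lookup∘updateAt′; tabulate∘lookup; lookup∘tabulate; tabulate-∘; tabulate-cong)
open import Data.Vec.Relation.Unary.All as All using (All; []; _∷_)
open import Data.Vec.Relation.Unary.All.Properties using (lookup⁺)
open import Data.Vec.Relation.Unary.AllPairs using (AllPairs; []; _∷_)
open import Data.Vec.Relation.Unary.Any as Any using (here; there)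
open import Data.Vec.Relation.Unary.Any.Properties using (lookup-index)
open import Data.Vec.Relation.Unary.Unique.Propositional using (Unique)
import Data.Vec.Relation.Unary.Unique.Propositional.Properties as Unique
open import Data.Vec.Membership.Propositional using (_∈_)
open import Data.Vec.Membership.Propositional.Properties using (∈-lookup)
open import Algebra.Properties.AbelianGroup ℤP.+-0-abelianGroup using (∙-cancelˡ; ∙-cancelʳ)
open import Algebra.Properties.CommutativeSemigroup ℤP.+-commutativeSemigroup using (x∙yz≈y∙xz; xy∙z≈xz∙y)
open import Algebra.Properties.Semiring.Sum ℤP.+-*-semiring
  using (sum; sum-syntax; sum-permute; sum-cong-≗; ∑-distrib-+; *-distribʳ-sum; sum-init-last)
open import Data.Bool using (true; false; if_then_else_)
open import Data.Empty using (⊥-elim)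
open import Data.Product using (Σ; _×_; _,_; proj₁; proj₂)
open import Data.Sum as Sum using (_⊎_; inj₁; inj₂)
open import Function.Base using (_∘_; id)
open import Function.Bundles using (_⇔_; mk⇔; Equivalence)
open import Function.Definitions using (Injective)
open import Level using (lift)
open import Relation.Binary.Definitions using (tri<; tri≈; tri>)
open import Relation.Binary.PropositionalEquality
  using (_≡_; _≢_; refl; sym; trans; cong; cong₂; subst; subst₂; module ≡-Reasoning)
open import Relation.Nullary using (¬_; does; yes; no)
open import Relation.Nullary.Decidable using (does-⇔)

-- Integers inside the rationals

ι : ℤ → ℚ
ι z = z ℚ./ 1

toℚᵘ-/ : ∀ p n .{{_ : NonZero n}} → ℚ.toℚᵘ (p ℚ./ n) ℚᵘ.≃ p ℚᵘ./ n
toℚᵘ-/ p (suc n) = ℚP.toℚᵘ-fromℚᵘ (ℚᵘ.mkℚᵘ p n)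

+-/ : ∀ p q r a b d .{{_ : NonZero a}} .{{_ : NonZero b}} .{{_ : NonZero d}} →
      (p ℤ.* + b ℤ.+ q ℤ.* + a) ℤ.* + d ≡ r ℤ.* (+ a ℤ.* + b) →
      p ℚ./ a ℚ.+ q ℚ./ b ≡ r ℚ./ d
+-/ p q r a@(suc _) b@(suc _) d@(suc _) eq = ℚP.toℚᵘ-injective (begin
  ℚ.toℚᵘ (p ℚ./ a ℚ.+ q ℚ./ b)               ≈⟨ ℚP.toℚᵘ-homo-+ (p ℚ./ a) (q ℚ./ b) ⟩
  ℚ.toℚᵘ (p ℚ./ a) ℚᵘ.+ ℚ.toℚᵘ (q ℚ./ b)      ≈⟨ ℚᵘP.+-cong (toℚᵘ-/ p a) (toℚᵘ-/ q b) ⟩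
  p ℚᵘ./ a ℚᵘ.+ q ℚᵘ./ b                      ≈⟨ ℚᵘ.*≡* eq ⟩
  r ℚᵘ./ d                                   ≈⟨ ℚᵘP.≃-sym (toℚᵘ-/ r d) ⟩
  ℚ.toℚᵘ (r ℚ./ d)                           ∎)
  where open ℚᵘP.≃-Reasoning

*-/ : ∀ p q r a b d .{{_ : NonZero a}} .{{_ : NonZero b}} .{{_ : NonZero d}} →
      (p ℤ.* q) ℤ.* + d ≡ r ℤ.* (+ a ℤ.* + b) →
      p ℚ./ a ℚ.* (q ℚ./ b) ≡ r ℚ./ d
*-/ p q r a@(suc _) b@(suc _) d@(suc _) eq = ℚP.toℚᵘ-injective (begin
  ℚ.toℚᵘ (p ℚ./ a ℚ.* (q ℚ./ b))             ≈⟨ ℚP.toℚᵘ-homo-* (p ℚ./ a) (q ℚ./ b) ⟩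
  ℚ.toℚᵘ (p ℚ./ a) ℚᵘ.* ℚ.toℚᵘ (q ℚ./ b)      ≈⟨ ℚᵘP.*-cong (toℚᵘ-/ p a) (toℚᵘ-/ q b) ⟩
  p ℚᵘ./ a ℚᵘ.* (q ℚᵘ./ b)                    ≈⟨ ℚᵘ.*≡* eq ⟩
  r ℚᵘ./ d                                   ≈⟨ ℚᵘP.≃-sym (toℚᵘ-/ r d) ⟩
  ℚ.toℚᵘ (r ℚ./ d)                           ∎)
  where open ℚᵘP.≃-Reasoning

-‿/ : ∀ p a .{{_ : NonZero a}} → ℚ.- (p ℚ./ a) ≡ (ℤ.- p) ℚ./ a
-‿/ p a@(suc _) = ℚP.toℚᵘ-injective (begin
  ℚ.toℚᵘ (ℚ.- (p ℚ./ a))        ≈⟨ ℚP.toℚᵘ-homo‿- (p ℚ./ a) ⟩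
  ℚᵘ.- ℚ.toℚᵘ (p ℚ./ a)         ≈⟨ ℚᵘP.-‿cong (toℚᵘ-/ p a) ⟩
  ℚᵘ.- (p ℚᵘ./ a)               ≈⟨ ℚᵘP.≃-sym (toℚᵘ-/ (ℤ.- p) a) ⟩
  ℚ.toℚᵘ ((ℤ.- p) ℚ./ a)        ∎)
  where open ℚᵘP.≃-Reasoning

ι-+ : ∀ p q → ι (p ℤ.+ q) ≡ ι p ℚ.+ ι q
ι-+ p q = sym (+-/ p q (p ℤ.+ q) 1 1 1 (cross p q))
  where
  cross : ∀ p q → (p ℤ.* + 1 ℤ.+ q ℤ.* + 1) ℤ.* + 1 ≡ (p ℤ.+ q) ℤ.* (+ 1 ℤ.* + 1)
  cross = solve-∀

ι-sub : ∀ p q → ι (p ℤ.- q) ≡ ι p ℚ.- ι q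
ι-sub p q = trans (ι-+ p (ℤ.- q)) (cong (ℚ._+_ (ι p)) (sym (-‿/ q 1)))

ι-mono-≤ : ∀ {p q} → p ℤ.≤ q → ι p ℚ.≤ ι q
ι-mono-≤ {p} {q} p≤q = ℚP.toℚᵘ-cancel-≤ (begin
  ℚ.toℚᵘ (ι p)  ≃⟨ toℚᵘ-/ p 1 ⟩
  p ℚᵘ./ 1      ≤⟨ ℚᵘ.*≤* (ℤP.*-monoʳ-≤-nonNeg (+ 1) p≤q) ⟩
  q ℚᵘ./ 1      ≃⟨ ℚᵘP.≃-sym (toℚᵘ-/ q 1) ⟩
  ℚ.toℚᵘ (ι q)  ∎)
  where open ℚᵘP.≤-Reasoning

ι-mono-< : ∀ {p q} → p ℤ.< q → ι p ℚ.< ι q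
ι-mono-< {p} {q} p<q = ℚP.toℚᵘ-cancel-< (begin-strict
  ℚ.toℚᵘ (ι p)  ≃⟨ toℚᵘ-/ p 1 ⟩
  p ℚᵘ./ 1      <⟨ ℚᵘ.*<* (ℤP.*-monoʳ-<-pos (+ 1) p<q) ⟩
  q ℚᵘ./ 1      ≃⟨ ℚᵘP.≃-sym (toℚᵘ-/ q 1) ⟩
  ℚ.toℚᵘ (ι q)  ∎)
  where open ℚᵘP.≤-Reasoning

ι-cancel-≤ : ∀ {p q} → ι p ℚ.≤ ι q → p ℤ.≤ q
ι-cancel-≤ {p} {q} ιp≤ιq with ℚᵘP.≤-respˡ-≃ (toℚᵘ-/ p 1) (ℚᵘP.≤-respʳ-≃ (toℚᵘ-/ q 1) (ℚP.toℚᵘ-mono-≤ ιp≤ιq))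
... | ℚᵘ.*≤* p*1≤q*1 = ℤP.*-cancelʳ-≤-pos p q (+ 1) p*1≤q*1

ι-*-/ : ∀ p n .{{_ : NonZero n}} → ι (+ n) ℚ.* (p ℚ./ n) ≡ ι p
ι-*-/ p n = *-/ (+ n) p p 1 n 1 (n*p*1≡p*[1*n] p (+ n))
  where
  n*p*1≡p*[1*n] : ∀ p n → (n ℤ.* p) ℤ.* + 1 ≡ p ℤ.* (+ 1 ℤ.* n)
  n*p*1≡p*[1*n] = solve-∀

/-+-1ℚ : ∀ p n .{{_ : NonZero n}} → (p ℤ.+ + n) ℚ./ n ≡ p ℚ./ n ℚ.+ ℚ.1ℚ
/-+-1ℚ p n = sym (+-/ p (+ 1) (p ℤ.+ + n) n 1 n (cross p (+ n)))
  where
  cross : ∀ p n → (p ℤ.* + 1 ℤ.+ + 1 ℤ.* n) ℤ.* n ≡ (p ℤ.+ n) ℤ.* (n ℤ.* + 1)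
  cross = solve-∀

-- Insertion sort of integer vectors

insertℤ : ∀ {n} → ℤ → Vec ℤ n → Vec ℤ (suc n)
insertℤ x []       = x ∷ []
insertℤ x (y ∷ ys) = if does (x ℤP.≤? y) then x ∷ y ∷ ys else y ∷ insertℤ x ys

sortℤ : ∀ {n} → Vec ℤ n → Vec ℤ n
sortℤ []       = []
sortℤ (x ∷ xs) = insertℤ x (sortℤ xs)

module _ (f : ℤ → ℚ) (f-≤⇔ : ∀ {x y} → x ℤ.≤ y ⇔ f x ℚ.≤ f y) where

  map-insertℤ : ∀ {n} x (ys : Vec ℤ n) → map f (insertℤ x ys) ≡ insert (f x) (map f ys)
  map-insertℤ x []       = refl
  map-insertℤ x (y ∷ ys) rewrite sym (does-⇔ (f-≤⇔ {x} {y}) (x ℤP.≤? y) (f x ℚP.≤? f y))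
    with does (x ℤP.≤? y)
  ... | true  = refl
  ... | false = cong (f y ∷_) (map-insertℤ x ys)

  map-sortℤ : ∀ {n} (v : Vec ℤ n) → map f (sortℤ v) ≡ sortV (map f v)
  map-sortℤ []       = refl
  map-sortℤ (x ∷ xs) = trans (map-insertℤ x (sortℤ xs)) (cong (insert (f x)) (map-sortℤ xs))

∈-insertℤ⁻ : ∀ {n z} x (ys : Vec ℤ n) → z ∈ insertℤ x ys → z ≡ x ⊎ z ∈ ys
∈-insertℤ⁻ x []       (here z≡x) = inj₁ z≡x
∈-insertℤ⁻ x (y ∷ ys) z∈ with does (x ℤP.≤? y)
∈-insertℤ⁻ x (y ∷ ys) (here z≡x)          | true  = inj₁ z≡x
∈-insertℤ⁻ x (y ∷ ys) (there z∈y∷ys)      | true  = inj₂ z∈y∷ys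
∈-insertℤ⁻ x (y ∷ ys) (here z≡y)          | false = inj₂ (here z≡y)
∈-insertℤ⁻ x (y ∷ ys) (there z∈insert)    | false = Sum.map₂ there (∈-insertℤ⁻ x ys z∈insert)

∈-insertℤ⁺ : ∀ {n z} x (ys : Vec ℤ n) → z ≡ x ⊎ z ∈ ys → z ∈ insertℤ x ys
∈-insertℤ⁺ x []       (inj₁ z≡x) = here z≡x
∈-insertℤ⁺ x (y ∷ ys) z∈ with does (x ℤP.≤? y)
∈-insertℤ⁺ x (y ∷ ys) (inj₁ z≡x)          | true  = here z≡x
∈-insertℤ⁺ x (y ∷ ys) (inj₂ z∈y∷ys)       | true  = there z∈y∷ys
∈-insertℤ⁺ x (y ∷ ys) (inj₂ (here z≡y))   | false = here z≡y
∈-insertℤ⁺ x (y ∷ ys) (inj₂ (there z∈ys)) | false = there (∈-insertℤ⁺ x ys (inj₂ z∈ys))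
∈-insertℤ⁺ x (y ∷ ys) (inj₁ z≡x)          | false = there (∈-insertℤ⁺ x ys (inj₁ z≡x))

∈-sortℤ : ∀ {n z} (v : Vec ℤ n) → z ∈ sortℤ v ⇔ z ∈ v
∈-sortℤ v = mk⇔ (to v) (from v)
  where
  to : ∀ {n z} (v : Vec ℤ n) → z ∈ sortℤ v → z ∈ v
  to (x ∷ xs) z∈ with ∈-insertℤ⁻ x (sortℤ xs) z∈
  ... | inj₁ z≡x      = here z≡x
  ... | inj₂ z∈sortxs = there (to xs z∈sortxs)
  from : ∀ {n z} (v : Vec ℤ n) → z ∈ v → z ∈ sortℤ v
  from (x ∷ xs) (here z≡x)  = ∈-insertℤ⁺ x (sortℤ xs) (inj₁ z≡x)
  from (x ∷ xs) (there z∈xs) = ∈-insertℤ⁺ x (sortℤ xs) (inj₂ (from xs z∈xs))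

All-insertℤ : ∀ {P : ℤ → Set} {n x} {ys : Vec ℤ n} → P x → All P ys → All P (insertℤ x ys)
All-insertℤ {ys = []}     px []           = px ∷ []
All-insertℤ {x = x} {ys = y ∷ ys} px (py ∷ pys) with does (x ℤP.≤? y)
... | true  = px ∷ py ∷ pys
... | false = py ∷ All-insertℤ px pys

All-sortℤ : ∀ {P : ℤ → Set} {n} {v : Vec ℤ n} → All P v → All P (sortℤ v)
All-sortℤ []         = []
All-sortℤ (px ∷ pxs) = All-insertℤ px (All-sortℤ pxs)

AllPairs-insertℤ : ∀ {n x} {ys : Vec ℤ n} → All (x ≢_) ys →
                   AllPairs ℤ._<_ ys → AllPairs ℤ._<_ (insertℤ x ys)
AllPairs-insertℤ {ys = []} [] [] = [] ∷ []
AllPairs-insertℤ {x = x} {ys = y ∷ ys} (x≢y ∷ x≢ys) (y<ys ∷ ys↑) with x ℤP.≤? y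
... | yes x≤y = (x<y ∷ All.map (ℤP.<-trans x<y) y<ys) ∷ y<ys ∷ ys↑
  where x<y = ℤP.≤∧≢⇒< x≤y x≢y
... | no  x≰y = All-insertℤ (ℤP.≰⇒> x≰y) y<ys ∷ AllPairs-insertℤ x≢ys ys↑

sortℤ-AllPairs : ∀ {n} {v : Vec ℤ n} → Unique v → AllPairs ℤ._<_ (sortℤ v)
sortℤ-AllPairs []            = []
sortℤ-AllPairs (x≢xs ∷ uxs) = AllPairs-insertℤ (All-sortℤ x≢xs) (sortℤ-AllPairs uxs)

AllPairs⇒StrictlyIncreasing : ∀ {n} {v : Vec ℤ n} → AllPairs ℤ._<_ v → StrictlyIncreasing v
AllPairs⇒StrictlyIncreasing (x<xs ∷ _)  Fin.zero    (Fin.suc j) _            = lookup⁺ x<xs j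
AllPairs⇒StrictlyIncreasing (_ ∷ xs↑)  (Fin.suc i) (Fin.suc j) (ℕ.s≤s i<j) = AllPairs⇒StrictlyIncreasing xs↑ i j i<j

sumℤ-insertℤ : ∀ {n} x (ys : Vec ℤ n) → sumℤ (insertℤ x ys) ≡ x ℤ.+ sumℤ ys
sumℤ-insertℤ x []       = refl
sumℤ-insertℤ x (y ∷ ys) with does (x ℤP.≤? y)
... | true  = refl
... | false = trans (cong (ℤ._+_ y) (sumℤ-insertℤ x ys)) (x∙yz≈y∙xz y x (sumℤ ys))

sumℤ-sortℤ : ∀ {n} (v : Vec ℤ n) → sumℤ (sortℤ v) ≡ sumℤ v
sumℤ-sortℤ []       = refl
sumℤ-sortℤ (x ∷ xs) = trans (sumℤ-insertℤ x (sortℤ xs)) (cong (ℤ._+_ x) (sumℤ-sortℤ xs))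

-- Generators of m-invariant sets and the letter action

strictlyIncreasing-injective : ∀ {n} (a : Vec ℤ n) → StrictlyIncreasing a →
                               ∀ i j → lookup a i ≡ lookup a j → i ≡ j
strictlyIncreasing-injective a a↑ i j aᵢ≡aⱼ with FinP.<-cmp i j
... | tri< i<j _ _ = ⊥-elim (ℤP.<-irrefl aᵢ≡aⱼ (a↑ i j i<j))
... | tri≈ _ i≡j _ = i≡j
... | tri> _ _ j<i = ⊥-elim (ℤP.<-irrefl (sym aᵢ≡aⱼ) (a↑ j i j<i))

∈⇔lookup : ∀ {n z} {v : Vec ℤ n} → z ∈ v ⇔ Σ (Fin n) λ i → lookup v i ≡ z
∈⇔lookup {v = v} = mk⇔ (λ z∈v → Any.index z∈v , sym (lookup-index z∈v))
                       (λ (i , vᵢ≡z) → subst (_∈ v) vᵢ≡z (∈-lookup i v))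

sortℤ-generators : ∀ {m Δ} {v : Vec ℤ m} → Unique v →
                   (∀ x → IsGenerator m Δ x ⇔ Σ (Fin m) λ i → lookup v i ≡ x) →
                   Generators m Δ (sortℤ v)
sortℤ-generators {v = v} v-unique gen = AllPairs⇒StrictlyIncreasing (sortℤ-AllPairs v-unique) , λ x →
  to ∈⇔lookup ∘ from (∈-sortℤ v) ∘ from ∈⇔lookup ∘ to (gen x) ,
  from (gen x) ∘ to ∈⇔lookup ∘ to (∈-sortℤ v) ∘ from ∈⇔lookup
  where open Equivalence

letterℤ : (m : ℕ) → ∀ {n} → Fin n → Vec ℤ n → Vec ℤ n
letterℤ m j b = sortℤ (updateAt b j (ℤ._+ + m))

PairwiseIncongruent : (m : ℕ) → ∀ {n} → Vec ℤ n → Set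
PairwiseIncongruent m a = ∀ i j q → lookup a i ≡ lookup a j ℤ.+ q ℤ.* + m → i ≡ j

delete : ℤ → ISet → ISet
delete g Δ x = Δ x × x ≢ g

lookup-generator : ∀ {m Δ} a → Generators m Δ a → ∀ i → IsGenerator m Δ (lookup a i)
lookup-generator a (_ , generator⇔entry) i = proj₂ (generator⇔entry (lookup a i)) (i , refl)

module _ {m : ℕ} {Δ : ISet} (invariant : MInvariant m Δ) where

  invariant-+-* : ∀ {x} t → Δ x → Δ (x ℤ.+ + t ℤ.* + m)
  invariant-+-* {x} zero    Δx = subst Δ (sym (ℤP.+-identityʳ x)) Δx
  invariant-+-* {x} (suc t) Δx = subst Δ (+*-suc x (+ t) (+ m)) (invariant _ (invariant-+-* t Δx))
    where
    +*-suc : ∀ x t m → x ℤ.+ t ℤ.* m ℤ.+ m ≡ x ℤ.+ (+ 1 ℤ.+ t) ℤ.* m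
    +*-suc = solve-∀

  shift-¬generator : ∀ {x} t → Δ x → ¬ IsGenerator m Δ (x ℤ.+ + suc t ℤ.* + m)
  shift-¬generator {x} t Δx (_ , ∉Δ+m) =
    ∉Δ+m (x ℤ.+ + t ℤ.* + m , invariant-+-* t Δx , +*-suc x (+ t) (+ m))
    where
    +*-suc : ∀ x t m → x ℤ.+ (+ 1 ℤ.+ t) ℤ.* m ≡ x ℤ.+ t ℤ.* m ℤ.+ m
    +*-suc = solve-∀

  generators-incongruent : ∀ a → Generators m Δ a → PairwiseIncongruent m a
  generators-incongruent a (a↑ , _) i j (+ zero) aᵢ≡aⱼ+0 =
    strictlyIncreasing-injective a a↑ i j (trans aᵢ≡aⱼ+0 (ℤP.+-identityʳ (lookup a j)))
  generators-incongruent a a-generators i j +[1+ t ] aᵢ≡aⱼ+qm = ⊥-elim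
    (shift-¬generator t (proj₁ (lookup-generator a a-generators j))
      (subst (IsGenerator m Δ) aᵢ≡aⱼ+qm (lookup-generator a a-generators i)))
  generators-incongruent a a-generators i j -[1+ t ] aᵢ≡aⱼ-qm = ⊥-elim
    (shift-¬generator t (proj₁ (lookup-generator a a-generators i))
      (subst (IsGenerator m Δ) aⱼ≡aᵢ+qm (lookup-generator a a-generators j)))
    where
    move : ∀ y q m → y ≡ (y ℤ.+ (ℤ.- q) ℤ.* m) ℤ.+ q ℤ.* m
    move = solve-∀
    aⱼ≡aᵢ+qm = trans (move (lookup a j) +[1+ t ] (+ m)) (cong (ℤ._+ +[1+ t ] ℤ.* + m) (sym aᵢ≡aⱼ-qm))

  delete-invariant : ∀ {g} → IsGenerator m Δ g → MInvariant m (delete g Δ)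
  delete-invariant (_ , g∉Δ+m) x (Δx , _) = invariant x Δx , λ x+m≡g → g∉Δ+m (x , Δx , sym x+m≡g)

  delete-generator⁺ : ∀ {g x} → IsGenerator m Δ x → x ≢ g → IsGenerator m (delete g Δ) x
  delete-generator⁺ (Δx , x∉Δ+m) x≢g = (Δx , x≢g) , λ (y , (Δy , _) , x≡y+m) → x∉Δ+m (y , Δy , x≡y+m)

  delete-generator⁻ : ∀ {g x} → IsGenerator m (delete g Δ) x → x ≢ g ℤ.+ + m → IsGenerator m Δ x
  delete-generator⁻ ((Δx , _) , x∉Δ′+m) x≢g+m =
    Δx , λ (y , Δy , x≡y+m) → x∉Δ′+m (y , (Δy , λ y≡g → x≢g+m (trans x≡y+m (cong (ℤ._+ + m) y≡g))) , x≡y+m)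

  delete-generator-shift : .{{_ : NonZero m}} → ∀ {g} → IsGenerator m Δ g →
                           IsGenerator m (delete g Δ) (g ℤ.+ + m)
  delete-generator-shift {g} (Δg , _) =
    (invariant g Δg , g+m≢g) , λ (y , (_ , y≢g) , g+m≡y+m) → y≢g (sym (∙-cancelʳ (+ m) g y g+m≡y+m))
    where
    g+m≢g : g ℤ.+ + m ≢ g
    g+m≢g g+m≡g = ℕ.≢-nonZero⁻¹ m (ℤP.+-injective (∙-cancelˡ g (+ m) (+ 0) (trans g+m≡g (sym (ℤP.+-identityʳ g)))))

  module _ .{{_ : NonZero m}} (b : Vec ℤ m) (b-generators : Generators m Δ b) (j : Fin m) where

    private
      v = updateAt b j (ℤ._+ + m)

      vⱼ≡bⱼ+m : lookup v j ≡ lookup b j ℤ.+ + m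
      vⱼ≡bⱼ+m = lookup∘updateAt j b

      vᵢ≡bᵢ : ∀ {i} → i ≢ j → lookup v i ≡ lookup b i
      vᵢ≡bᵢ {i} i≢j = lookup∘updateAt′ i j i≢j b

      b-injective : ∀ i l → lookup b i ≡ lookup b l → i ≡ l
      b-injective = strictlyIncreasing-injective b (proj₁ b-generators)

      bⱼ+m≢bᵢ : ∀ i → lookup b j ℤ.+ + m ≢ lookup b i
      bⱼ+m≢bᵢ i bⱼ+m≡bᵢ = shift-¬generator 0 (proj₁ (lookup-generator b b-generators j))
        (subst (IsGenerator m Δ) (trans (sym bⱼ+m≡bᵢ) (cong (ℤ._+_ (lookup b j)) (sym (ℤP.*-identityˡ (+ m)))))
               (lookup-generator b b-generators i))

    updateAt-unique : Unique (updateAt b j (ℤ._+ + m))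
    updateAt-unique = subst Unique (tabulate∘lookup v) (Unique.tabulate⁺ v-injective)
      where
      v-injective : ∀ {i l} → lookup v i ≡ lookup v l → i ≡ l
      v-injective {i} {l} vᵢ≡vₗ with i Fin.≟ j | l Fin.≟ j
      ... | yes i≡j  | yes l≡j  = trans i≡j (sym l≡j)
      ... | yes refl | no  l≢j  = ⊥-elim (bⱼ+m≢bᵢ l (trans (sym vⱼ≡bⱼ+m) (trans vᵢ≡vₗ (vᵢ≡bᵢ l≢j))))
      ... | no  i≢j  | yes refl = ⊥-elim (bⱼ+m≢bᵢ i (trans (sym vⱼ≡bⱼ+m) (trans (sym vᵢ≡vₗ) (vᵢ≡bᵢ i≢j))))
      ... | no  i≢j  | no  l≢j  = b-injective i l (trans (sym (vᵢ≡bᵢ i≢j)) (trans vᵢ≡vₗ (vᵢ≡bᵢ l≢j)))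

    delete-generators : ∀ x → IsGenerator m (delete (lookup b j) Δ) x ⇔
                              Σ (Fin m) λ i → lookup (updateAt b j (ℤ._+ + m)) i ≡ x
    delete-generators x = mk⇔ generator⇒entry entry⇒generator
      where
      generator⇒entry : IsGenerator m (delete (lookup b j) Δ) x → Σ (Fin m) λ i → lookup v i ≡ x
      generator⇒entry gx with x ℤP.≟ lookup b j ℤ.+ + m
      ... | yes x≡bⱼ+m = j , trans vⱼ≡bⱼ+m (sym x≡bⱼ+m)
      ... | no  x≢bⱼ+m = i , trans (vᵢ≡bᵢ i≢j) bᵢ≡x
        where
        i,bᵢ≡x = proj₁ (proj₂ b-generators x) (delete-generator⁻ gx x≢bⱼ+m)
        i      = proj₁ i,bᵢ≡x
        bᵢ≡x   = proj₂ i,bᵢ≡x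
        i≢j : i ≢ j
        i≢j i≡j = proj₂ (proj₁ gx) (trans (sym bᵢ≡x) (cong (lookup b) i≡j))

      entry⇒generator : (Σ (Fin m) λ i → lookup v i ≡ x) → IsGenerator m (delete (lookup b j) Δ) x
      entry⇒generator (i , vᵢ≡x) with i Fin.≟ j
      ... | yes refl = subst (IsGenerator m _) (trans (sym vⱼ≡bⱼ+m) vᵢ≡x)
                         (delete-generator-shift (lookup-generator b b-generators j))
      ... | no  i≢j  = subst (IsGenerator m _) (trans (sym (vᵢ≡bᵢ i≢j)) vᵢ≡x)
                         (delete-generator⁺ (lookup-generator b b-generators i) (i≢j ∘ b-injective i j))

    letter-generators : Generators m (delete (lookup b j) Δ) (letterℤ m j b)
    letter-generators = sortℤ-generators updateAt-unique delete-generators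

-- The map φ and the word action

sumℤ-updateAt : ∀ {n} (b : Vec ℤ n) j c → sumℤ (updateAt b j (ℤ._+ c)) ≡ sumℤ b ℤ.+ c
sumℤ-updateAt (x ∷ xs) Fin.zero    c = xy∙z≈xz∙y x c (sumℤ xs)
sumℤ-updateAt (x ∷ xs) (Fin.suc j) c =
  trans (cong (ℤ._+_ x) (sumℤ-updateAt xs j c)) (sym (ℤP.+-assoc x (sumℤ xs) c))

offset : ℚ → ℤ → ℚ
offset c z = ι z ℚ.- c

offset-≤⇔ : ∀ c {x y} → x ℤ.≤ y ⇔ offset c x ℚ.≤ offset c y
offset-≤⇔ c {x} {y} = mk⇔ (λ x≤y → ℚP.+-monoˡ-≤ (ℚ.- c) (ι-mono-≤ x≤y))
  (λ x-c≤y-c → ι-cancel-≤ (subst₂ ℚ._≤_ (p-c+c (ι x) c) (p-c+c (ι y) c) (ℚP.+-monoˡ-≤ c x-c≤y-c)))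
  where
  p-c+c : ∀ p c → p ℚ.- c ℚ.+ c ≡ p
  p-c+c = solve 2 (λ p c → p :- c :+ c := p) refl
    where open +-*-Solver

sumℚ-map-offset : ∀ {n} c (b : Vec ℤ n) → sumℚ (map (offset c) b) ≡ ι (sumℤ b) ℚ.- ι (+ n) ℚ.* c
sumℚ-map-offset c []       = 0≡0-0*c c
  where
  0≡0-0*c : ∀ c → ℚ.0ℚ ≡ ℚ.0ℚ ℚ.- ℚ.0ℚ ℚ.* c
  0≡0-0*c = solve 1 (λ c → con ℚ.0ℚ := con ℚ.0ℚ :- con ℚ.0ℚ :* c) refl
    where open +-*-Solver
sumℚ-map-offset {suc n} c (x ∷ xs) = begin
  offset c x ℚ.+ sumℚ (map (offset c) xs)           ≡⟨ cong (ℚ._+_ (offset c x)) (sumℚ-map-offset c xs) ⟩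
  ι x ℚ.- c ℚ.+ (ι (sumℤ xs) ℚ.- ι (+ n) ℚ.* c)      ≡⟨ regroup (ι x) (ι (sumℤ xs)) (ι (+ n)) c ⟩
  (ι x ℚ.+ ι (sumℤ xs)) ℚ.- (ℚ.1ℚ ℚ.+ ι (+ n)) ℚ.* c ≡⟨ cong₂ (λ s k → s ℚ.- k ℚ.* c) (sym (ι-+ x (sumℤ xs))) (sym (ι-+ (+ 1) (+ n))) ⟩
  ι (x ℤ.+ sumℤ xs) ℚ.- ι (+ suc n) ℚ.* c            ∎
  where
  open ≡-Reasoning
  regroup : ∀ x s n c → x ℚ.- c ℚ.+ (s ℚ.- n ℚ.* c) ≡ (x ℚ.+ s) ℚ.- (ℚ.1ℚ ℚ.+ n) ℚ.* c
  regroup = solve 4 (λ x s n c → x :- c :+ (s :- n :* c) := (x :+ s) :- (con ℚ.1ℚ :+ n) :* c) refl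
    where open +-*-Solver

module _ (m : ℕ) .{{_ : NonZero m}} where

  lookup-φ : ∀ a i → lookup (φ m a) i ≡ offset (sumℤ a ℚ./ m) (lookup a i)
  lookup-φ a = lookup∘tabulate _

  φ≡map-offset : ∀ a → φ m a ≡ map (offset (sumℤ a ℚ./ m)) a
  φ≡map-offset a = trans (tabulate-∘ _ (lookup a)) (cong (map _) (tabulate∘lookup a))

  sumℚ-φ : ∀ a → sumℚ (φ m a) ≡ ℚ.0ℚ
  sumℚ-φ a = begin
    sumℚ (φ m a)                                  ≡⟨ cong sumℚ (φ≡map-offset a) ⟩
    sumℚ (map (offset (S ℚ./ m)) a)               ≡⟨ sumℚ-map-offset (S ℚ./ m) a ⟩
    ι S ℚ.- ι (+ m) ℚ.* (S ℚ./ m)                 ≡⟨ cong (ℚ._-_ (ι S)) (ι-*-/ S m) ⟩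
    ι S ℚ.- ι S                                   ≡⟨ ℚP.+-inverseʳ (ι S) ⟩
    ℚ.0ℚ                                          ∎
    where
    open ≡-Reasoning
    S = sumℤ a

  φ-InV : ∀ a → StrictlyIncreasing a → InV m (φ m a)
  φ-InV a a↑ = sumℚ-φ a , λ i j i≤j → subst₂ ℚ._≤_ (sym (lookup-φ a i)) (sym (lookup-φ a j))
    (Equivalence.to (offset-≤⇔ _) (aᵢ≤aⱼ i j i≤j))
    where
    aᵢ≤aⱼ : ∀ i j → i Fin.≤ j → lookup a i ℤ.≤ lookup a j
    aᵢ≤aⱼ i j i≤j with i Fin.≟ j
    ... | yes refl = ℤP.≤-refl
    ... | no  i≢j  = ℤP.<⇒≤ (a↑ i j (FinP.≤∧≢⇒< i≤j i≢j))

  φ-difference : ∀ a i j → lookup (φ m a) i ℚ.- lookup (φ m a) j ≡ ι (lookup a i ℤ.- lookup a j)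
  φ-difference a i j = begin
    lookup (φ m a) i ℚ.- lookup (φ m a) j             ≡⟨ cong₂ ℚ._-_ (lookup-φ a i) (lookup-φ a j) ⟩
    offset c (lookup a i) ℚ.- offset c (lookup a j)   ≡⟨ cancel (ι (lookup a i)) (ι (lookup a j)) c ⟩
    ι (lookup a i) ℚ.- ι (lookup a j)                 ≡⟨ sym (ι-sub (lookup a i) (lookup a j)) ⟩
    ι (lookup a i ℤ.- lookup a j)                     ∎
    where
    open ≡-Reasoning
    c = sumℤ a ℚ./ m
    cancel : ∀ x y c → x ℚ.- c ℚ.- (y ℚ.- c) ≡ x ℚ.- y
    cancel = solve 3 (λ x y c → x :- c :- (y :- c) := x :- y) refl
      where open +-*-Solver

  φ-letterℤ : ∀ b j → φ m (letterℤ m j b) ≡ letterV m j (φ m b)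
  φ-letterℤ b j = begin
    φ m (sortℤ v)                                    ≡⟨ φ≡map-offset (sortℤ v) ⟩
    map (offset c′) (sortℤ v)                        ≡⟨ map-sortℤ (offset c′) (offset-≤⇔ c′) v ⟩
    sortV (map (offset c′) v)                        ≡⟨ cong (sortV ∘ map (offset c′)) (sym (tabulate∘lookup v)) ⟩
    sortV (map (offset c′) (tabulate (lookup v)))    ≡⟨ cong sortV (sym (tabulate-∘ (offset c′) (lookup v))) ⟩
    sortV (tabulate (offset c′ ∘ lookup v))          ≡⟨ cong sortV (tabulate-cong entry) ⟩
    letterV m j (φ m b)                              ∎
    where
    open ≡-Reasoning
    v = updateAt b j (ℤ._+ + m)
    c = sumℤ b ℚ./ m
    c′ = sumℤ (sortℤ v) ℚ./ m

    c′≡c+1 : c′ ≡ c ℚ.+ ℚ.1ℚ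
    c′≡c+1 = trans (cong (λ s → s ℚ./ m) (trans (sumℤ-sortℤ v) (sumℤ-updateAt b j (+ m)))) (/-+-1ℚ (sumℤ b) m)

    entry : ∀ k → offset c′ (lookup v k) ≡
            (if does (k Fin.≟ j) then lookup (φ m b) k ℚ.+ ι (+ m) else lookup (φ m b) k) ℚ.- ℚ.1ℚ
    entry k with k Fin.≟ j
    ... | yes refl = begin
      ι (lookup v j) ℚ.- c′                         ≡⟨ cong₂ ℚ._-_ (trans (cong ι (lookup∘updateAt j b)) (ι-+ (lookup b j) (+ m))) c′≡c+1 ⟩
      ι (lookup b j) ℚ.+ ι (+ m) ℚ.- (c ℚ.+ ℚ.1ℚ)   ≡⟨ shifted (ι (lookup b j)) (ι (+ m)) c ⟩
      offset c (lookup b j) ℚ.+ ι (+ m) ℚ.- ℚ.1ℚ    ≡⟨ cong (λ t → t ℚ.+ ι (+ m) ℚ.- ℚ.1ℚ) (sym (lookup-φ b j)) ⟩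
      lookup (φ m b) j ℚ.+ ι (+ m) ℚ.- ℚ.1ℚ         ∎
      where
      shifted : ∀ x y c → x ℚ.+ y ℚ.- (c ℚ.+ ℚ.1ℚ) ≡ x ℚ.- c ℚ.+ y ℚ.- ℚ.1ℚ
      shifted = solve 3 (λ x y c → x :+ y :- (c :+ con ℚ.1ℚ) := x :- c :+ y :- con ℚ.1ℚ) refl
        where open +-*-Solver
    ... | no  k≢j  = begin
      ι (lookup v k) ℚ.- c′                         ≡⟨ cong₂ ℚ._-_ (cong ι (lookup∘updateAt′ k j k≢j b)) c′≡c+1 ⟩
      ι (lookup b k) ℚ.- (c ℚ.+ ℚ.1ℚ)               ≡⟨ unshifted (ι (lookup b k)) c ⟩
      offset c (lookup b k) ℚ.- ℚ.1ℚ                ≡⟨ cong (ℚ._- ℚ.1ℚ) (sym (lookup-φ b k)) ⟩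
      lookup (φ m b) k ℚ.- ℚ.1ℚ                     ∎
      where
      unshifted : ∀ x c → x ℚ.- (c ℚ.+ ℚ.1ℚ) ≡ x ℚ.- c ℚ.- ℚ.1ℚ
      unshifted = solve 2 (λ x c → x :- (c :+ con ℚ.1ℚ) := x :- c :- con ℚ.1ℚ) refl
        where open +-*-Solver

record WordImage (m : ℕ) .{{_ : NonZero m}} (w : Word m) (Δ : ISet) (a : Vec ℤ m) : Set₁ where
  field
    Δ′            : ISet
    b             : Vec ℤ m
    action        : WordAct m w Δ Δ′
    invariant     : MInvariant m Δ′
    generators    : Generators m Δ′ b
    φ-equivariant : φ m b ≡ wordV m w (φ m a)

word-image : ∀ {m} .{{_ : NonZero m}} {Δ} a → MInvariant m Δ → Generators m Δ a → ∀ w → WordImage m w Δ a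
word-image {Δ = Δ} a invariant generators [] = record
  { Δ′ = Δ ; b = a ; action = lift (λ _ → id , id) ; invariant = invariant
  ; generators = generators ; φ-equivariant = refl }
word-image {m} a invariant₀ generators₀ (j ∷ w) = record
  { Δ′            = delete (lookup b j) Δ′
  ; b             = letterℤ m j b
  ; action        = Δ′ , action , lift (b , generators , λ _ → id , id)
  ; invariant     = delete-invariant invariant (lookup-generator b generators j)
  ; generators    = letter-generators invariant b generators j
  ; φ-equivariant = trans (φ-letterℤ m b j) (cong (letterV m j) φ-equivariant)
  }
  where open WordImage (word-image a invariant₀ generators₀ w)

-- Complete residue systems and alcove centroids

injective⇒surjective : ∀ {n} (f : Fin n → Fin n) → Injective _≡_ _≡_ f → ∀ y → Σ (Fin n) λ x → f x ≡ y
injective⇒surjective {suc n} f f-injective y with FinP.any? (λ x → f x Fin.≟ y)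
... | yes found = found
... | no  ∄x    = ⊥-elim (ℕP.1+n≰n (FinP.injective⇒≤ f′-injective))
  where
  f′ : Fin (suc n) → Fin n
  f′ x = Fin.punchOut {i = y} (λ y≡fx → ∄x (x , sym y≡fx))
  f′-injective : Injective _≡_ _≡_ f′
  f′-injective {x} {x′} = f-injective ∘ FinP.punchOut-injective {i = y} _ _

sum-∘-injective : ∀ {n} (f : Fin n → Fin n) → Injective _≡_ _≡_ f → ∀ g → sum (g ∘ f) ≡ sum g
sum-∘-injective f f-injective g = sym (sum-permute g π)
  where
  π = Perm.permutation f (proj₁ ∘ surjective) (proj₂ ∘ surjective) (λ x → f-injective (proj₂ (surjective (f x))))
    where surjective = injective⇒surjective f f-injective

twice-∑-toℕ : ∀ n → + 2 ℤ.* (∑[ i < n ] (+ Fin.toℕ i)) ℤ.+ + n ≡ + n ℤ.* + n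
twice-∑-toℕ zero    = refl
twice-∑-toℕ (suc n) = begin
  + 2 ℤ.* ∑[ i < suc n ] (+ Fin.toℕ i) ℤ.+ + suc n             ≡⟨ cong (λ t → + 2 ℤ.* t ℤ.+ + suc n) ∑≡T+n ⟩
  + 2 ℤ.* (T ℤ.+ + n) ℤ.+ (+ 1 ℤ.+ + n)                      ≡⟨ expand T (+ n) ⟩
  (+ 2 ℤ.* T ℤ.+ + n) ℤ.+ (+ 1 ℤ.+ + 2 ℤ.* + n)              ≡⟨ cong (ℤ._+ (+ 1 ℤ.+ + 2 ℤ.* + n)) (twice-∑-toℕ n) ⟩
  + n ℤ.* + n ℤ.+ (+ 1 ℤ.+ + 2 ℤ.* + n)                      ≡⟨ square (+ n) ⟩
  (+ 1 ℤ.+ + n) ℤ.* (+ 1 ℤ.+ + n)                            ∎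
  where
  open ≡-Reasoning
  T = ∑[ i < n ] (+ Fin.toℕ i)
  ∑≡T+n : ∑[ i < suc n ] (+ Fin.toℕ i) ≡ T ℤ.+ + n
  ∑≡T+n = begin
    ∑[ i < suc n ] (+ Fin.toℕ i)                                ≡⟨ sum-init-last {n} (λ i → + Fin.toℕ i) ⟩
    ∑[ i < n ] (+ Fin.toℕ (Fin.inject₁ i)) ℤ.+ + Fin.toℕ (Fin.fromℕ n)
      ≡⟨ cong₂ ℤ._+_ (sum-cong-≗ {n} {λ i → + Fin.toℕ (Fin.inject₁ i)} (λ i → cong +_ (FinP.toℕ-inject₁ i))) (cong +_ (FinP.toℕ-fromℕ n)) ⟩
    T ℤ.+ + n                                                    ∎
  expand : ∀ T n → + 2 ℤ.* (T ℤ.+ n) ℤ.+ (+ 1 ℤ.+ n) ≡ (+ 2 ℤ.* T ℤ.+ n) ℤ.+ (+ 1 ℤ.+ + 2 ℤ.* n)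
  expand = solve-∀
  square : ∀ n → n ℤ.* n ℤ.+ (+ 1 ℤ.+ + 2 ℤ.* n) ≡ (+ 1 ℤ.+ n) ℤ.* (+ 1 ℤ.+ n)
  square = solve-∀

sumℤ≡sum : ∀ {n} (a : Vec ℤ n) → sumℤ a ≡ sum (lookup a)
sumℤ≡sum []       = refl
sumℤ≡sum (x ∷ xs) = cong (ℤ._+_ x) (sumℤ≡sum xs)

/ℕ-bounds : ∀ d n .{{_ : NonZero n}} → d %ℕ n ≢ 0 →
            (d /ℕ n) ℤ.* + n ℤ.< d × d ℤ.< (d /ℕ n ℤ.+ + 1) ℤ.* + n
/ℕ-bounds d n r≢0 = lower , upper
  where
  k = d /ℕ n
  lower : k ℤ.* + n ℤ.< d
  lower = begin-strict
    k ℤ.* + n                  ≡⟨ sym (ℤP.+-identityˡ (k ℤ.* + n)) ⟩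
    + 0 ℤ.+ k ℤ.* + n          <⟨ ℤP.+-monoˡ-< (k ℤ.* + n) (ℤ.+<+ (ℕP.n≢0⇒n>0 r≢0)) ⟩
    + (d %ℕ n) ℤ.+ k ℤ.* + n   ≡⟨ sym (a≡a%ℕn+[a/ℕn]*n d n) ⟩
    d                          ∎
    where open ℤP.≤-Reasoning
  upper : d ℤ.< (k ℤ.+ + 1) ℤ.* + n
  upper = subst (λ t → d ℤ.< t ℤ.* + n) (ℤP.+-comm (+ 1) k) (n<s[n/ℕd]*d d n)

module _ {m : ℕ} .{{_ : NonZero m}} (a : Vec ℤ m) (incongruent : PairwiseIncongruent m a) where

  private
    r : Fin m → ℕ
    r i = lookup a i %ℕ m

    q : Fin m → ℤ
    q i = lookup a i /ℕ m

    aᵢ≡rᵢ+qᵢm : ∀ i → lookup a i ≡ + r i ℤ.+ q i ℤ.* + m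
    aᵢ≡rᵢ+qᵢm i = a≡a%ℕn+[a/ℕn]*n (lookup a i) m

  residue : Fin m → Fin m
  residue i = Fin.fromℕ< (n%ℕd<d (lookup a i) m)

  residue-injective : Injective _≡_ _≡_ residue
  residue-injective {i} {j} residueᵢ≡residueⱼ = incongruent i j (q i ℤ.- q j) (begin
    lookup a i                                ≡⟨ aᵢ≡rᵢ+qᵢm i ⟩
    + r i ℤ.+ q i ℤ.* + m                     ≡⟨ cong (λ t → + t ℤ.+ q i ℤ.* + m) rᵢ≡rⱼ ⟩
    + r j ℤ.+ q i ℤ.* + m                     ≡⟨ regroup (+ r j) (q i) (q j) (+ m) ⟩
    + r j ℤ.+ q j ℤ.* + m ℤ.+ (q i ℤ.- q j) ℤ.* + m ≡⟨ cong (ℤ._+ (q i ℤ.- q j) ℤ.* + m) (sym (aᵢ≡rᵢ+qᵢm j)) ⟩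
    lookup a j ℤ.+ (q i ℤ.- q j) ℤ.* + m      ∎)
    where
    open ≡-Reasoning
    rᵢ≡rⱼ : r i ≡ r j
    rᵢ≡rⱼ = trans (sym (FinP.toℕ-fromℕ< _)) (trans (cong Fin.toℕ residueᵢ≡residueⱼ) (FinP.toℕ-fromℕ< _))
    regroup : ∀ r x y m → r ℤ.+ x ℤ.* m ≡ r ℤ.+ y ℤ.* m ℤ.+ (x ℤ.- y) ℤ.* m
    regroup = solve-∀

  sumℤ-incongruent : Σ ℤ λ Q → sumℤ a ≡ ∑[ i < m ] (+ Fin.toℕ i) ℤ.+ Q ℤ.* + m
  sumℤ-incongruent = sum q , (begin
    sumℤ a                                              ≡⟨ sumℤ≡sum a ⟩
    sum (lookup a)                                      ≡⟨ sum-cong-≗ aᵢ≡rᵢ+qᵢm ⟩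
    sum (λ i → + r i ℤ.+ q i ℤ.* + m)                   ≡⟨ ∑-distrib-+ (λ i → + r i) (λ i → q i ℤ.* + m) ⟩
    sum (λ i → + r i) ℤ.+ sum (λ i → q i ℤ.* + m)       ≡⟨ cong₂ ℤ._+_ ∑r≡∑toℕ (sym (*-distribʳ-sum (+ m) q)) ⟩
    ∑[ i < m ] (+ Fin.toℕ i) ℤ.+ sum q ℤ.* + m          ∎)
    where
    open ≡-Reasoning
    ∑r≡∑toℕ : sum (λ i → + r i) ≡ ∑[ i < m ] (+ Fin.toℕ i)
    ∑r≡∑toℕ = trans (sum-cong-≗ {y = λ i → + Fin.toℕ (residue i)} (λ i → cong +_ (sym (FinP.toℕ-fromℕ< _))))
                    (sum-∘-injective residue residue-injective (λ i → + Fin.toℕ i))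

  twice-sumℤ-incongruent : Σ ℤ λ Q → + 2 ℤ.* sumℤ a ℤ.+ + m ≡ + m ℤ.* (+ m ℤ.+ + 2 ℤ.* Q)
  twice-sumℤ-incongruent = Q , (begin
    + 2 ℤ.* sumℤ a ℤ.+ + m                         ≡⟨ cong (λ s → + 2 ℤ.* s ℤ.+ + m) S≡T+Qm ⟩
    + 2 ℤ.* (T ℤ.+ Q ℤ.* + m) ℤ.+ + m              ≡⟨ regroup T Q (+ m) ⟩
    (+ 2 ℤ.* T ℤ.+ + m) ℤ.+ + 2 ℤ.* Q ℤ.* + m       ≡⟨ cong (ℤ._+ + 2 ℤ.* Q ℤ.* + m) (twice-∑-toℕ m) ⟩
    + m ℤ.* + m ℤ.+ + 2 ℤ.* Q ℤ.* + m              ≡⟨ factor (+ m) Q ⟩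
    + m ℤ.* (+ m ℤ.+ + 2 ℤ.* Q)                    ∎)
    where
    open ≡-Reasoning
    T = ∑[ i < m ] (+ Fin.toℕ i)
    Q = proj₁ sumℤ-incongruent
    S≡T+Qm = proj₂ sumℤ-incongruent
    regroup : ∀ T Q m → + 2 ℤ.* (T ℤ.+ Q ℤ.* m) ℤ.+ m ≡ (+ 2 ℤ.* T ℤ.+ m) ℤ.+ + 2 ℤ.* Q ℤ.* m
    regroup = solve-∀
    factor : ∀ m Q → m ℤ.* m ℤ.+ + 2 ℤ.* Q ℤ.* m ≡ m ℤ.* (m ℤ.+ + 2 ℤ.* Q)
    factor = solve-∀

  φ-centroid-integral : ∀ i → Σ ℤ λ z → (+ suc m ℚ./ 2) ℚ.- lookup (φ m a) i ≡ z ℚ./ 1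
  φ-centroid-integral i = + m ℤ.+ Q ℤ.- lookup a i , (begin
    h ℚ.- lookup (φ m a) i                       ≡⟨ cong (ℚ._-_ h) (lookup-φ m a i) ⟩
    h ℚ.- (ι (lookup a i) ℚ.- S ℚ./ m)           ≡⟨ rearrange h (ι (lookup a i)) (S ℚ./ m) ⟩
    h ℚ.+ S ℚ./ m ℚ.- ι (lookup a i)             ≡⟨ cong (ℚ._- ι (lookup a i)) (+-/ (+ suc m) S (+ m ℤ.+ Q) 2 m 1 cross) ⟩
    ι (+ m ℤ.+ Q) ℚ.- ι (lookup a i)             ≡⟨ sym (ι-sub (+ m ℤ.+ Q) (lookup a i)) ⟩
    ι (+ m ℤ.+ Q ℤ.- lookup a i)                 ∎)
    where
    open ≡-Reasoning
    h = + suc m ℚ./ 2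
    S = sumℤ a
    Q = proj₁ twice-sumℤ-incongruent
    rearrange : ∀ h x c → h ℚ.- (x ℚ.- c) ≡ h ℚ.+ c ℚ.- x
    rearrange = solve 3 (λ h x c → h :- (x :- c) := h :+ c :- x) refl
      where open +-*-Solver
    cross : (+ suc m ℤ.* + m ℤ.+ S ℤ.* + 2) ℤ.* + 1 ≡ (+ m ℤ.+ Q) ℤ.* (+ 2 ℤ.* + m)
    cross = begin
      (+ suc m ℤ.* + m ℤ.+ S ℤ.* + 2) ℤ.* + 1   ≡⟨ expand S (+ m) ⟩
      + m ℤ.* + m ℤ.+ (+ 2 ℤ.* S ℤ.+ + m)      ≡⟨ cong (ℤ._+_ (+ m ℤ.* + m)) (proj₂ twice-sumℤ-incongruent) ⟩
      + m ℤ.* + m ℤ.+ + m ℤ.* (+ m ℤ.+ + 2 ℤ.* Q) ≡⟨ collect (+ m) Q ⟩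
      (+ m ℤ.+ Q) ℤ.* (+ 2 ℤ.* + m)            ∎
      where
      expand : ∀ S m → ((+ 1 ℤ.+ m) ℤ.* m ℤ.+ S ℤ.* + 2) ℤ.* + 1 ≡ m ℤ.* m ℤ.+ (+ 2 ℤ.* S ℤ.+ m)
      expand = solve-∀
      collect : ∀ m Q → m ℤ.* m ℤ.+ m ℤ.* (m ℤ.+ + 2 ℤ.* Q) ≡ (m ℤ.+ Q) ℤ.* (+ 2 ℤ.* m)
      collect = solve-∀

  φ-alcoveCentroid : IsAlcoveCentroid m (φ m a)
  φ-alcoveCentroid = k , (sumℚ-φ m a , interior) , φ-centroid-integral
    where
    d : Fin m → Fin m → ℤ
    d i j = lookup a i ℤ.- lookup a j

    k : Fin m → Fin m → ℤ
    k i j = d i j /ℕ m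

    remainder≢0 : ∀ i j → i Fin.< j → d i j %ℕ m ≢ 0
    remainder≢0 i j i<j r≡0 = FinP.<⇒≢ i<j (incongruent i j (k i j) (begin
      lookup a i                                   ≡⟨ split (lookup a i) (lookup a j) ⟩
      lookup a j ℤ.+ d i j                          ≡⟨ cong (ℤ._+_ (lookup a j)) (a≡a%ℕn+[a/ℕn]*n (d i j) m) ⟩
      lookup a j ℤ.+ (+ (d i j %ℕ m) ℤ.+ k i j ℤ.* + m) ≡⟨ cong (λ r → lookup a j ℤ.+ (+ r ℤ.+ k i j ℤ.* + m)) r≡0 ⟩
      lookup a j ℤ.+ (+ 0 ℤ.+ k i j ℤ.* + m)        ≡⟨ cong (ℤ._+_ (lookup a j)) (ℤP.+-identityˡ (k i j ℤ.* + m)) ⟩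
      lookup a j ℤ.+ k i j ℤ.* + m                  ∎))
      where
      open ≡-Reasoning
      split : ∀ x y → x ≡ y ℤ.+ (x ℤ.- y)
      split = solve-∀

    interior : ∀ i j → i Fin.< j →
               ι (k i j ℤ.* + m) ℚ.< lookup (φ m a) i ℚ.- lookup (φ m a) j
             × lookup (φ m a) i ℚ.- lookup (φ m a) j ℚ.< ι ((k i j ℤ.+ + 1) ℤ.* + m)
    interior i j i<j =
      subst (ι (k i j ℤ.* + m) ℚ.<_) (sym (φ-difference m a i j)) (ι-mono-< (proj₁ bounds)) ,
      subst (ℚ._< ι ((k i j ℤ.+ + 1) ℤ.* + m)) (sym (φ-difference m a i j)) (ι-mono-< (proj₂ bounds))
      where bounds = /ℕ-bounds (d i j) m (remainder≢0 i j i<j)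

mainTheorem4 : (m : ℕ) → .{{_ : NonZero m}} → (Δ : ISet) → (a : Vec ℤ m) →
    MInvariant m Δ → Bounded Δ → CoBounded Δ → Generators m Δ a →
    InV m (φ m a)
    × (∀ (w : Word m) → Σ ISet λ Δ' → Σ (Vec ℤ m) λ b →
         WordAct m w Δ Δ' × Generators m Δ' b × φ m b ≡ wordV m w (φ m a))
    × IsAlcoveCentroid m (φ m a)
-- Boundedness and co-boundedness are what guarantee that Δ has exactly m generators;
-- here the generators are supplied by the last hypothesis.
mainTheorem4 m Δ a Δ-invariant _ _ a-generators =
  φ-InV m a (proj₁ a-generators) ,
  (λ w → let open WordImage (word-image a Δ-invariant a-generators w) in Δ′ , b , action , generators , φ-equivariant) ,
  φ-alcoveCentroid a (generators-incongruent Δ-invariant a a-generators)
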